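{- Let $h \geq 1$, let $u_1,\ldots,u_h$ be nonzero integers, and let $\varphi(x_1,\ldots,x_h,y) = u_1x_1 + \cdots + u_hx_h + y$. Let $\mathcal{A} = (A_1,\ldots,A_h)$ be an $h$-tuple of nonempty finite sets of integers and let $t \geq 1$ be an integer. Suppose there is a strictly increasing sequence $(L_N)_{N\geq 1}$ of positive integers such that for every $N \geq 1$ there exist a set $B_N$ of integers and a set $I_N$ consisting of $2L_N+1$ consecutive integers with $R^{(\varphi)}_{\mathcal{A},B_N}(n) = t$ for all $n \in I_N$. Then there exists a set $B$ of integers such that $R^{(\varphi)}_{\mathcal{A},B}(n) = t$ for all $n \in \mathbf{Z}$.
   Context: For an $h$-tuple $\mathcal{A}=(A_1,\ldots,A_h)$ of sets of integers and a set $B$ of integers, $R^{(\varphi)}_{\mathcal{A},B}(n) = \mathrm{card}\{(a_1,\ldots,a_h,b) \in A_1\times\cdots\times A_h\times B : \varphi(a_1,\ldots,a_h,b) = n\}$. -}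

module Defs where

open import Level using (0ℓ)
open import Data.Nat using (ℕ)
open import Data.Integer using (ℤ; _+_; _*_)
open import Data.Product using (Σ; _×_; _,_; ∃)
open import Data.Vec using (Vec; lookup; zipWith; foldr)
open import Data.Fin using (Fin)
open import Data.List using (List; length)
open import Data.List.Membership.Propositional using (_∈_)
open import Data.List.Relation.Unary.Unique.Propositional using (Unique)
open import Relation.Binary.PropositionalEquality using (_≡_)
open import Relation.Unary using (Pred)
open import Function.Bundles using (_⇔_)

SetZ : Set₁
SetZ = Pred ℤ 0ℓ

-- Finite cardinality: card {x : X | P x} = t  iff there is a duplicate-free
-- list of length t whose members are exactly the elements satisfying P.
CardEq : {X : Set} → Pred X 0ℓ → ℕ → Set
CardEq {X} P t = Σ (List X) λ xs → (length xs ≡ t) × Unique xs × (∀ x → (P x ⇔ (x ∈ xs)))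

φ : {h : ℕ} → Vec ℤ h → Vec ℤ h → ℤ → ℤ
φ u x y = foldr _ _+_ y (zipWith _*_ u x)

RepSet : {h : ℕ} → Vec ℤ h → Vec (List ℤ) h → SetZ → ℤ → Pred (Vec ℤ h × ℤ) 0ℓ
RepSet u A B n (a , b) = (∀ i → lookup a i ∈ lookup A i) × B b × (φ u a b ≡ n)

R≡ : {h : ℕ} → Vec ℤ h → Vec (List ℤ) h → SetZ → ℤ → ℕ → Set
R≡ u A B n t = CardEq (RepSet u A B n) t

{-# OPTIONS --safe #-}
-- The count R(n) only sees B inside [n - M, n + M], where M bounds |u₁a₁ + ⋯ + u_h a_h| on
-- A₁ × ⋯ × A_h. Where R = t, membership in B is decidable (the finite list of representations
-- witnesses it), so among 2^W + 1 consecutive windows of width W = 2M + 1 two carry the same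
-- pattern, at distance p say. Then B is p-periodic on a stretch of length p + W, and around every
-- n its p-periodic extension B′ looks like B around some m in the interval with m ≡ n (mod p);
-- hence R_{A,B′}(n) = R_{A,B}(m) = t. Since L_N ≥ N, some interval I_N is long enough.
module Submission where

open import Defs
open import Level using (0ℓ)
open import Data.Nat as ℕ using (ℕ; zero; suc; _≤_; _<_; _*_; _^_; _%_; _/_; z≤n; s≤s)
import Data.Nat.Properties as ℕ
open import Data.Nat.DivMod using (m≡m%n+[m/n]*n; m%n<n)
open import Data.Nat.ListAction using (sum)
open import Data.Integer as ℤ using (ℤ; _+_; _-_; +_; -[1+_]; 0ℤ; _⊖_; _%ℕ_; _/ℕ_)
import Data.Integer.Properties as ℤ
open import Data.Integer.DivMod using (a≡a%ℕn+[a/ℕn]*n; n%ℕd<d)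
open import Data.Integer.Tactic.RingSolver using (solve-∀)
open import Data.Fin as Fin using (Fin; toℕ)
import Data.Fin.Properties as Fin
open import Data.Vec using (Vec; []; _∷_; lookup; tabulate)
import Data.Vec.Properties as Vec
open import Data.List as List using (List; [])
import Data.List.Properties as List
open import Data.List.Membership.Propositional using (_∈_)
open import Data.List.Membership.Propositional.Properties using (∈-map⁺; ∈-map⁻)
import Data.List.Membership.DecPropositional as DecMembership
open import Data.List.Relation.Unary.Any using (here; there)
import Data.List.Relation.Unary.Unique.Propositional.Properties as Unique
open import Data.Product using (Σ; _×_; _,_; proj₁; proj₂)
open import Data.Product.Properties using () renaming (≡-dec to ×-≡-dec)
open import Function using (_∘_)
open import Function.Bundles using (_⇔_; _↔_; mk⇔; mk↔ₛ′; Inverse; Equivalence)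
import Function.Properties.Equivalence as ⇔
open import Relation.Binary.Definitions using (DecidableEquality)
open import Relation.Binary.PropositionalEquality
  using (_≡_; _≢_; refl; sym; trans; cong; subst; subst₂; module ≡-Reasoning)
open import Relation.Nullary using (Dec; yes; no; contradiction)
import Relation.Nullary.Decidable as Dec
open import Relation.Unary using (Pred; Decidable)

CardEq-↔ : {X Y : Set} {P : Pred X 0ℓ} {Q : Pred Y 0ℓ} (e : X ↔ Y) →
           (∀ x → P x ⇔ Q (Inverse.to e x)) → ∀ {t} → CardEq P t → CardEq Q t
CardEq-↔ {P = P} {Q} e P⇔Q (xs , len , xs! , P⇔∈) =
  List.map to xs , trans (List.length-map to xs) len , Unique.map⁺ to-injective xs! ,
  λ y → mk⇔ (Q⇒∈ y) (∈⇒Q y)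
  where
  open Inverse e
  to-injective : ∀ {x x′} → to x ≡ to x′ → x ≡ x′
  to-injective {x} {x′} eq = trans (sym (strictlyInverseʳ x)) (trans (cong from eq) (strictlyInverseʳ x′))
  Q⇒∈ : ∀ y → Q y → y ∈ List.map to xs
  Q⇒∈ y Qy = subst (_∈ List.map to xs) (strictlyInverseˡ y)
    (∈-map⁺ to (Equivalence.to (P⇔∈ (from y))
      (Equivalence.from (P⇔Q (from y)) (subst Q (sym (strictlyInverseˡ y)) Qy))))
  ∈⇒Q : ∀ y → y ∈ List.map to xs → Q y
  ∈⇒Q y y∈ with x , x∈xs , refl ← ∈-map⁻ to y∈ =
    Equivalence.to (P⇔Q x) (Equivalence.from (P⇔∈ x) x∈xs)

CardEq-decidable : {X : Set} {P : Pred X 0ℓ} {t : ℕ} →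
                   DecidableEquality X → CardEq P t → Decidable P
CardEq-decidable _≟_ (xs , _ , _ , P⇔∈) x = Dec.map′ (Equivalence.from (P⇔∈ x)) (Equivalence.to (P⇔∈ x)) (x ∈? xs)
  where open DecMembership _≟_ using (_∈?_)

offset : ∀ {h} → Vec ℤ h → Vec ℤ h → ℤ
offset u a = φ u a 0ℤ

φ≡offset+ : ∀ {h} (u a : Vec ℤ h) b → φ u a b ≡ offset u a + b
φ≡offset+ []       []       b = sym (ℤ.+-identityˡ b)
φ≡offset+ (x ∷ u) (y ∷ a) b = begin
  x ℤ.* y + φ u a b            ≡⟨ cong (λ v → x ℤ.* y + v) (φ≡offset+ u a b) ⟩
  x ℤ.* y + (offset u a + b)   ≡⟨ ℤ.+-assoc (x ℤ.* y) (offset u a) b ⟨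
  x ℤ.* y + offset u a + b     ∎
  where open ≡-Reasoning

φ≡⇒≡- : ∀ {h} (u a : Vec ℤ h) {b n} → φ u a b ≡ n → b ≡ n - offset u a
φ≡⇒≡- u a {b} φ≡n = trans (b≡s+b-s (offset u a) b) (cong (_- offset u a) (trans (sym (φ≡offset+ u a b)) φ≡n))
  where
  b≡s+b-s : ∀ s b → b ≡ s + b - s
  b≡s+b-s = solve-∀

φ-+ : ∀ {h} (u a : Vec ℤ h) b d → φ u a (b + d) ≡ φ u a b + d
φ-+ u a b d = begin
  φ u a (b + d)         ≡⟨ φ≡offset+ u a (b + d) ⟩
  offset u a + (b + d)  ≡⟨ ℤ.+-assoc (offset u a) b d ⟨
  offset u a + b + d    ≡⟨ cong (_+ d) (φ≡offset+ u a b) ⟨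
  φ u a b + d           ∎
  where open ≡-Reasoning

infix 4 _∈Π_
_∈Π_ : ∀ {h} → Vec ℤ h → Vec (List ℤ) h → Set
a ∈Π A = ∀ i → lookup a i ∈ lookup A i

∈Π-nonempty : ∀ {h} (A : Vec (List ℤ) h) → (∀ i → lookup A i ≢ []) → Σ (Vec ℤ h) (_∈Π A)
∈Π-nonempty A A≢[] = tabulate (proj₁ ∘ member) ,
  λ i → subst (_∈ lookup A i) (sym (Vec.lookup∘tabulate (proj₁ ∘ member) i)) (proj₂ (member i))
  where
  member : ∀ i → Σ ℤ (_∈ lookup A i)
  member i with lookup A i | A≢[] i
  ... | []         | X≢[] = contradiction refl X≢[]
  ... | x List.∷ _ | _    = x , here refl

R≡-transfer : ∀ {h} (u : Vec ℤ h) (A : Vec (List ℤ) h) {B B′ : SetZ} {m n : ℤ} {t : ℕ} →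
              (∀ a → a ∈Π A → B (m - offset u a) ⇔ B′ (n - offset u a)) →
              R≡ u A B m t → R≡ u A B′ n t
R≡-transfer {h} u A {B} {B′} {m} {n} B⇔B′ = CardEq-↔ translate RepSet⇔
  where
  d = n - m
  translate : (Vec ℤ h × ℤ) ↔ (Vec ℤ h × ℤ)
  translate = mk↔ₛ′ (λ (a , b) → a , b + d) (λ (a , b) → a , b - d)
    (λ (a , b) → cong (a ,_) (b-d+d≡b b d)) (λ (a , b) → cong (a ,_) (b+d-d≡b b d))
    where
    b-d+d≡b : ∀ b d → b - d + d ≡ b
    b-d+d≡b = solve-∀
    b+d-d≡b : ∀ b d → b + d - d ≡ b
    b+d-d≡b = solve-∀
  ≡m⇔+d≡n : ∀ i → i ≡ m ⇔ i + d ≡ n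
  ≡m⇔+d≡n i = mk⇔ (λ i≡m → trans (cong (_+ d) i≡m) (m+[n-m]≡n m n))
                  (λ i+d≡n → trans (i≡i+d-d i d) (trans (cong (_- d) i+d≡n) (n-[n-m]≡m m n)))
    where
    m+[n-m]≡n : ∀ m n → m + (n - m) ≡ n
    m+[n-m]≡n = solve-∀
    i≡i+d-d : ∀ i d → i ≡ i + d - d
    i≡i+d-d = solve-∀
    n-[n-m]≡m : ∀ m n → n - (n - m) ≡ m
    n-[n-m]≡m = solve-∀
  φ≡m⇔ : ∀ a b → φ u a b ≡ m ⇔ φ u a (b + d) ≡ n
  φ≡m⇔ a b = subst (λ x → φ u a b ≡ m ⇔ x ≡ n) (sym (φ-+ u a b d)) (≡m⇔+d≡n (φ u a b))
  B⇔B′-at : ∀ {a b} → a ∈Π A → φ u a b ≡ m → B b ⇔ B′ (b + d)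
  B⇔B′-at {a} {b} a∈A φ≡m = subst₂ (λ x y → B x ⇔ B′ y)
    (sym (φ≡⇒≡- u a φ≡m)) (sym (φ≡⇒≡- u a (Equivalence.to (φ≡m⇔ a b) φ≡m))) (B⇔B′ a a∈A)
  RepSet⇔ : ∀ ab → RepSet u A B m ab ⇔ RepSet u A B′ n (Inverse.to translate ab)
  RepSet⇔ (a , b) = mk⇔
    (λ (a∈A , Bb , φ≡m) → a∈A , Equivalence.to (B⇔B′-at a∈A φ≡m) Bb , Equivalence.to (φ≡m⇔ a b) φ≡m)
    (λ (a∈A , B′b+d , φ≡n) → let φ≡m = Equivalence.from (φ≡m⇔ a b) φ≡n in
                               a∈A , Equivalence.from (B⇔B′-at a∈A φ≡m) B′b+d , φ≡m)

R≡⇒decidable : ∀ {h} (u : Vec ℤ h) (A : Vec (List ℤ) h) {B : SetZ} {a : Vec ℤ h} {b : ℤ} {t : ℕ} →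
               a ∈Π A → R≡ u A B (φ u a b) t → Dec (B b)
R≡⇒decidable u A {B} {a} {b} a∈A R≡t =
  Dec.map′ (proj₁ ∘ proj₂) (λ Bb → a∈A , Bb , refl) (CardEq-decidable _≟_ R≡t (a , b))
  where
  _≟_ : DecidableEquality (Vec ℤ _ × ℤ)
  _≟_ = ×-≡-dec (Vec.≡-dec ℤ._≟_) ℤ._≟_

∣x∣≤sum∣xs∣ : ∀ {x : ℤ} {xs} → x ∈ xs → ℤ.∣ x ∣ ≤ sum (List.map ℤ.∣_∣ xs)
∣x∣≤sum∣xs∣ (here refl) = ℕ.m≤m+n _ _
∣x∣≤sum∣xs∣ {xs = y List.∷ _} (there x∈xs) = ℕ.m≤n⇒m≤o+n ℤ.∣ y ∣ (∣x∣≤sum∣xs∣ x∈xs)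

offsetBound : ∀ {h} → Vec ℤ h → Vec (List ℤ) h → ℕ
offsetBound []       []       = 0
offsetBound (x ∷ u) (X ∷ A) = ℤ.∣ x ∣ * sum (List.map ℤ.∣_∣ X) ℕ.+ offsetBound u A

∣offset∣≤offsetBound : ∀ {h} (u : Vec ℤ h) (A : Vec (List ℤ) h) {a} → a ∈Π A →
                       ℤ.∣ offset u a ∣ ≤ offsetBound u A
∣offset∣≤offsetBound []       []       {[]}    _   = z≤n
∣offset∣≤offsetBound (x ∷ u) (X ∷ A) {y ∷ a} a∈A = begin
  ℤ.∣ x ℤ.* y + offset u a ∣
    ≤⟨ ℤ.∣i+j∣≤∣i∣+∣j∣ (x ℤ.* y) (offset u a) ⟩
  ℤ.∣ x ℤ.* y ∣ ℕ.+ ℤ.∣ offset u a ∣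
    ≡⟨ cong (ℕ._+ ℤ.∣ offset u a ∣) (ℤ.∣i*j∣≡∣i∣*∣j∣ x y) ⟩
  ℤ.∣ x ∣ * ℤ.∣ y ∣ ℕ.+ ℤ.∣ offset u a ∣
    ≤⟨ ℕ.+-mono-≤ (ℕ.*-monoʳ-≤ ℤ.∣ x ∣ (∣x∣≤sum∣xs∣ (a∈A Fin.zero)))
                  (∣offset∣≤offsetBound u A (a∈A ∘ Fin.suc)) ⟩
  ℤ.∣ x ∣ * sum (List.map ℤ.∣_∣ X) ℕ.+ offsetBound u A
    ∎
  where open ℕ.≤-Reasoning

∣i∣≤n⇒i+z≡n : ∀ i {n} → ℤ.∣ i ∣ ≤ n → Σ ℕ λ z → z ≤ n ℕ.+ n × i + + z ≡ + n
∣i∣≤n⇒i+z≡n (+ m)      {n} m≤n =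
  n ℕ.∸ m , ℕ.m≤n⇒m≤n+o n (ℕ.m∸n≤m n m) , trans (sym (ℤ.pos-+ m (n ℕ.∸ m))) (cong +_ (ℕ.m+[n∸m]≡n m≤n))
∣i∣≤n⇒i+z≡n -[1+ m ]   {n} m<n =
  n ℕ.+ suc m , ℕ.+-monoʳ-≤ n m<n , trans (cong (λ v → -[1+ m ] + v) (ℤ.pos-+ n (suc m))) (-y+[x+y]≡x (+ n) (+ suc m))
  where
  -y+[x+y]≡x : ∀ x y → ℤ.- y + (x + y) ≡ x
  -y+[x+y]≡x = solve-∀

pos-+-assoc : ∀ β i r → β + + (i ℕ.+ r) ≡ β + + i + + r
pos-+-assoc β i r = trans (cong (λ v → β + v) (ℤ.pos-+ i r)) (sym (ℤ.+-assoc β (+ i) (+ r)))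

remainder-unique : ∀ d .{{_ : ℕ.NonZero d}} {r r′ : ℕ} (k k′ : ℤ) → r < d → r′ < d →
                   + r + k ℤ.* + d ≡ + r′ + k′ ℤ.* + d → r ≡ r′
remainder-unique d {r} {r′} k k′ r<d r′<d eq = ℤ.+-injective (ℤ.i-j≡0⇒i≡j (+ r) (+ r′) r-r′≡0)
  where
  r-r′≡δd : + r - + r′ ≡ (k′ - k) ℤ.* + d
  r-r′≡δd = begin
    + r - + r′                          ≡⟨ r-r′≡r+kd-r′-kd (+ r) (+ r′) k (+ d) ⟩
    + r + k ℤ.* + d - + r′ - k ℤ.* + d   ≡⟨ cong (λ v → v - + r′ - k ℤ.* + d) eq ⟩
    + r′ + k′ ℤ.* + d - + r′ - k ℤ.* + d ≡⟨ r′+k′d-r′-kd≡[k′-k]d (+ r′) k k′ (+ d) ⟩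
    (k′ - k) ℤ.* + d                    ∎
    where
    open ≡-Reasoning
    r-r′≡r+kd-r′-kd : ∀ r r′ k d → r - r′ ≡ r + k ℤ.* d - r′ - k ℤ.* d
    r-r′≡r+kd-r′-kd = solve-∀
    r′+k′d-r′-kd≡[k′-k]d : ∀ r′ k k′ d → r′ + k′ ℤ.* d - r′ - k ℤ.* d ≡ (k′ - k) ℤ.* d
    r′+k′d-r′-kd≡[k′-k]d = solve-∀
  ∣δ∣*d<1*d : ℤ.∣ k′ - k ∣ * d < 1 * d
  ∣δ∣*d<1*d = begin-strict
    ℤ.∣ k′ - k ∣ * d           ≡⟨ ℤ.∣i*j∣≡∣i∣*∣j∣ (k′ - k) (+ d) ⟨
    ℤ.∣ (k′ - k) ℤ.* + d ∣     ≡⟨ cong ℤ.∣_∣ (trans (sym r-r′≡δd) (ℤ.m-n≡m⊖n r r′)) ⟩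
    ℤ.∣ r ⊖ r′ ∣               ≤⟨ ℤ.∣m⊝n∣≤m⊔n r r′ ⟩
    r ℕ.⊔ r′                   <⟨ ℕ.⊔-pres-<m r<d r′<d ⟩
    d                          ≡⟨ ℕ.*-identityˡ d ⟨
    1 * d                      ∎
    where open ℕ.≤-Reasoning
  r-r′≡0 : + r - + r′ ≡ 0ℤ
  r-r′≡0 = trans r-r′≡δd
    (cong (ℤ._* + d) (ℤ.∣i∣≡0⇒i≡0 {k′ - k} (ℕ.n<1⇒n≡0 (ℕ.*-cancelʳ-< d ℤ.∣ k′ - k ∣ 1 ∣δ∣*d<1*d))))

%ℕ-unique : ∀ i d .{{_ : ℕ.NonZero d}} {r : ℕ} (k : ℤ) → r < d → i ≡ + r + k ℤ.* + d → i %ℕ d ≡ r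
%ℕ-unique i d k r<d i≡ =
  remainder-unique d (i /ℕ d) k (n%ℕd<d i d) r<d (trans (sym (a≡a%ℕn+[a/ℕn]*n i d)) i≡)

[w+kd]%ℕd≡w%d : ∀ w d .{{_ : ℕ.NonZero d}} (k : ℤ) → (+ w + k ℤ.* + d) %ℕ d ≡ w % d
[w+kd]%ℕd≡w%d w d k = %ℕ-unique (+ w + k ℤ.* + d) d (k + + (w / d)) (m%n<n w d) (begin
  + w + k ℤ.* + d                                  ≡⟨ cong (λ v → + v + k ℤ.* + d) (m≡m%n+[m/n]*n w d) ⟩
  + (w % d ℕ.+ w / d * d) + k ℤ.* + d              ≡⟨ cong (_+ k ℤ.* + d) (ℤ.pos-+ (w % d) (w / d * d)) ⟩
  + (w % d) + + (w / d * d) + k ℤ.* + d            ≡⟨ cong (λ v → + (w % d) + v + k ℤ.* + d) (ℤ.pos-* (w / d) d) ⟩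
  + (w % d) + + (w / d) ℤ.* + d + k ℤ.* + d        ≡⟨ regroup (+ (w % d)) (+ (w / d)) k (+ d) ⟩
  + (w % d) + (k + + (w / d)) ℤ.* + d              ∎)
  where
  open ≡-Reasoning
  regroup : ∀ r q k d → r + q ℤ.* d + k ℤ.* d ≡ r + (k + q) ℤ.* d
  regroup = solve-∀

module _ (D : ℕ → Set) {p W : ℕ} (window : ∀ r → r < W → D r ⇔ D (p ℕ.+ r)) where

  ⇔-multiple : ∀ k r → k * p ℕ.+ r < p ℕ.+ W → D r ⇔ D (k * p ℕ.+ r)
  ⇔-multiple zero    r _  = ⇔.refl
  ⇔-multiple (suc k) r lt = ⇔.trans (⇔-multiple k r (ℕ.<-≤-trans kp+r<W (ℕ.m≤n+m W p)))
    (subst (λ x → D (k * p ℕ.+ r) ⇔ D x) (sym (ℕ.+-assoc p (k * p) r)) (window (k * p ℕ.+ r) kp+r<W))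
    where
    kp+r<W : k * p ℕ.+ r < W
    kp+r<W = ℕ.+-cancelˡ-< p (k * p ℕ.+ r) W (subst (_< p ℕ.+ W) (ℕ.+-assoc p (k * p) r) lt)

  %-window : .{{_ : ℕ.NonZero p}} → ∀ j → j < p ℕ.+ W → D (j % p) ⇔ D j
  %-window j j<p+W = subst (λ x → D (j % p) ⇔ D x) (sym j≡) (⇔-multiple (j / p) (j % p) (subst (_< p ℕ.+ W) j≡ j<p+W))
    where
    j≡ : j ≡ j / p * p ℕ.+ j % p
    j≡ = trans (m≡m%n+[m/n]*n j p) (ℕ.+-comm (j % p) (j / p * p))

bit : {P : Set} → Dec P → Fin 2
bit (yes _) = Fin.suc Fin.zero
bit (no _)  = Fin.zero

bit≡⇒⇔ : {P Q : Set} (P? : Dec P) (Q? : Dec Q) → bit P? ≡ bit Q? → P ⇔ Q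
bit≡⇒⇔ (yes p) (yes q) _ = mk⇔ (λ _ → q) (λ _ → p)
bit≡⇒⇔ (no ¬p) (no ¬q) _ = mk⇔ (λ p → contradiction p ¬p) (λ q → contradiction q ¬q)

module _ (D : ℕ → Set) (W : ℕ) (D? : ∀ j → j < 2 ^ W ℕ.+ W → Dec (D j)) where

  private
    profile : Fin (suc (2 ^ W)) → Fin W → Fin 2
    profile i r = bit (D? (toℕ i ℕ.+ toℕ r) (ℕ.+-mono-≤-< (ℕ.≤-pred (Fin.toℕ<n i)) (Fin.toℕ<n r)))

  -- Opaque: letting later conversion checks unfold the pigeonhole search is prohibitively expensive.
  opaque
    repeatedWindow : Σ ℕ λ i → Σ ℕ λ j → i < j × j ≤ 2 ^ W × (∀ r → r < W → D (i ℕ.+ r) ⇔ D (j ℕ.+ r))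
    repeatedWindow with i , j , i<j , sameCode ← Fin.pigeonhole (ℕ.n<1+n (2 ^ W)) (Fin.funToFin ∘ profile) =
      toℕ i , toℕ j , i<j , ℕ.≤-pred (Fin.toℕ<n j) , sameWindow
      where
      sameProfile : ∀ r → profile i r ≡ profile j r
      sameProfile r = begin
        profile i r                               ≡⟨ Fin.finToFun-funToFin (profile i) r ⟨
        Fin.finToFun (Fin.funToFin (profile i)) r ≡⟨ cong (λ c → Fin.finToFun c r) sameCode ⟩
        Fin.finToFun (Fin.funToFin (profile j)) r ≡⟨ Fin.finToFun-funToFin (profile j) r ⟩
        profile j r                               ∎
        where open ≡-Reasoning
      sameWindow : ∀ r → r < W → D (toℕ i ℕ.+ r) ⇔ D (toℕ j ℕ.+ r)
      sameWindow r r<W = subst (λ x → D (toℕ i ℕ.+ x) ⇔ D (toℕ j ℕ.+ x)) (Fin.toℕ-fromℕ< r<W)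
        (bit≡⇒⇔ (D? _ _) (D? _ _) (sameProfile (Fin.fromℕ< r<W)))

periodicExtension : SetZ → ℤ → (p : ℕ) .{{_ : ℕ.NonZero p}} → SetZ
periodicExtension B q p x = B (q + + ((x - q) %ℕ p))

module _ (B : SetZ) (q : ℤ) (p W : ℕ) .{{_ : ℕ.NonZero p}}
         (window : ∀ r → r < W → B (q + + r) ⇔ B (q + + (p ℕ.+ r))) where

  periodicExtension-agrees : ∀ w (k : ℤ) → w < p ℕ.+ W →
                             periodicExtension B q p (q + + w + k ℤ.* + p) ⇔ B (q + + w)
  periodicExtension-agrees w k w<p+W =
    subst (λ x → B (q + + x) ⇔ B (q + + w)) (sym residue) (%-window (λ r → B (q + + r)) window w w<p+W)
    where
    q+w+kp-q≡w+kp : ∀ q w k p → q + w + k ℤ.* p - q ≡ w + k ℤ.* p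
    q+w+kp-q≡w+kp = solve-∀
    residue : (q + + w + k ℤ.* + p - q) %ℕ p ≡ w ℕ.% p
    residue = trans (cong (_%ℕ p) (q+w+kp-q≡w+kp q (+ w) k (+ p))) ([w+kd]%ℕd≡w%d w p k)

windowLength : ∀ {h} → Vec ℤ h → Vec (List ℤ) h → ℕ
windowLength u A = suc (offsetBound u A ℕ.+ offsetBound u A)

requiredLength : ∀ {h} → Vec ℤ h → Vec (List ℤ) h → ℕ
requiredLength u A = 2 ^ windowLength u A ℕ.+ windowLength u A

module _ {h} (u : Vec ℤ h) (A : Vec (List ℤ) h) (B : SetZ) (q : ℤ) (p : ℕ) .{{_ : ℕ.NonZero p}} {t : ℕ}
         (window : ∀ r → r < windowLength u A → B (q + + r) ⇔ B (q + + (p ℕ.+ r)))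
         (R≡-period : ∀ k → k < p → R≡ u A B (q + + (k ℕ.+ offsetBound u A)) t) where

  private
    M = offsetBound u A

  R≡-periodicExtension : ∀ n → R≡ u A (periodicExtension B q p) n t
  R≡-periodicExtension n = R≡-transfer u A B⇔extension (R≡-period k k<p)
    where
    -- n is paired with m = q + (k + M), k being the residue of n - q - M mod p: for every offset s
    -- (with s + z = M), m - s = q + (k + z) and n - s ≡ m - s (mod p), where k + z < p + W.
    y = n - q - + M
    k = y %ℕ p
    k<p = n%ℕd<d y p
    B⇔extension : ∀ a → a ∈Π A → B (q + + (k ℕ.+ M) - offset u a) ⇔ periodicExtension B q p (n - offset u a)
    B⇔extension a a∈A with z , z≤2M , s+z≡M ← ∣i∣≤n⇒i+z≡n (offset u a) (∣offset∣≤offsetBound u A {a} a∈A) =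
      subst₂ (λ x x′ → B x ⇔ periodicExtension B q p x′) (sym m-s≡) (sym n-s≡)
        (⇔.sym (periodicExtension-agrees B q p (windowLength u A) window (k ℕ.+ z) (y /ℕ p)
                  (ℕ.+-mono-<-≤ k<p (ℕ.m≤n⇒m≤1+n z≤2M))))
      where
      open ≡-Reasoning
      s = offset u a
      m-s≡ : q + + (k ℕ.+ M) - s ≡ q + + (k ℕ.+ z)
      m-s≡ = begin
        q + + (k ℕ.+ M) - s          ≡⟨ cong (λ v → q + v - s) (ℤ.pos-+ k M) ⟩
        q + (+ k + + M) - s          ≡⟨ cong (λ v → q + (+ k + v) - s) (sym s+z≡M) ⟩
        q + (+ k + (s + + z)) - s    ≡⟨ cancel q (+ k) s (+ z) ⟩
        q + (+ k + + z)              ≡⟨ cong (λ v → q + v) (ℤ.pos-+ k z) ⟨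
        q + + (k ℕ.+ z)              ∎
        where
        cancel : ∀ q k s z → q + (k + (s + z)) - s ≡ q + (k + z)
        cancel = solve-∀
      n-s≡ : n - s ≡ q + + (k ℕ.+ z) + y /ℕ p ℤ.* + p
      n-s≡ = begin
        n - s                                  ≡⟨ regroup n q s (+ z) ⟩
        q + + z + (n - q - (s + + z))          ≡⟨ cong (λ v → q + + z + (n - q - v)) s+z≡M ⟩
        q + + z + y                            ≡⟨ cong (λ v → q + + z + v) (a≡a%ℕn+[a/ℕn]*n y p) ⟩
        q + + z + (+ k + y /ℕ p ℤ.* + p)        ≡⟨ swap q (+ z) (+ k) (y /ℕ p ℤ.* + p) ⟩
        q + (+ k + + z) + y /ℕ p ℤ.* + p        ≡⟨ cong (λ v → q + v + y /ℕ p ℤ.* + p) (ℤ.pos-+ k z) ⟨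
        q + + (k ℕ.+ z) + y /ℕ p ℤ.* + p        ∎
        where
        regroup : ∀ n q s z → n - s ≡ q + z + (n - q - (s + z))
        regroup = solve-∀
        swap : ∀ q z k x → q + z + (k + x) ≡ q + (k + z) + x
        swap = solve-∀

R≡-interval⇒decidable : ∀ {h} (u : Vec ℤ h) (A : Vec (List ℤ) h) {t : ℕ} {B : SetZ} {c : ℤ} {K : ℕ} {a : Vec ℤ h} →
                        a ∈Π A → (∀ k → k ≤ K → R≡ u A B (c + + k) t) →
                        ∀ e → e ≤ K → Dec (B (c - offset u a + + e))
R≡-interval⇒decidable u A {t} {B} {c} {a = a} a∈A R≡-interval e e≤K =
  R≡⇒decidable u A a∈A (subst (λ x → R≡ u A B x t) (sym φ≡c+e) (R≡-interval e e≤K))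
  where
  s+[c-s+e]≡c+e : ∀ s c e → s + (c - s + e) ≡ c + e
  s+[c-s+e]≡c+e = solve-∀
  φ≡c+e : φ u a (c - offset u a + + e) ≡ c + + e
  φ≡c+e = trans (φ≡offset+ u a _) (s+[c-s+e]≡c+e (offset u a) c (+ e))

R≡-interval⇒R≡-shifted : ∀ {h} (u : Vec ℤ h) (A : Vec (List ℤ) h) {t : ℕ} {B : SetZ} {c : ℤ} {K : ℕ} {a : Vec ℤ h} →
                         a ∈Π A → (∀ k → k ≤ K → R≡ u A B (c + + k) t) →
                         ∀ e → e ℕ.+ (offsetBound u A ℕ.+ offsetBound u A) ≤ K →
                         R≡ u A B (c - offset u a + + (e ℕ.+ offsetBound u A)) t
R≡-interval⇒R≡-shifted u A {t} {B} {c} {K} {a} a∈A R≡-interval e e+2M≤K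
  with z , z≤2M , s+z≡M ← ∣i∣≤n⇒i+z≡n (offset u a) (∣offset∣≤offsetBound u A {a} a∈A) =
  subst (λ x → R≡ u A B x t) (sym shifted≡c+z+e)
    (R≡-interval (z ℕ.+ e) (ℕ.≤-trans (ℕ.≤-trans (ℕ.+-monoˡ-≤ e z≤2M) (ℕ.≤-reflexive (ℕ.+-comm _ e))) e+2M≤K))
  where
  M = offsetBound u A
  s = offset u a
  shifted≡c+z+e : c - s + + (e ℕ.+ M) ≡ c + + (z ℕ.+ e)
  shifted≡c+z+e = begin
    c - s + + (e ℕ.+ M)         ≡⟨ cong (λ v → c - s + v) (ℤ.pos-+ e M) ⟩
    c - s + (+ e + + M)         ≡⟨ cong (λ v → c - s + (+ e + v)) s+z≡M ⟨
    c - s + (+ e + (s + + z))   ≡⟨ cancel c s (+ e) (+ z) ⟩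
    c + (+ z + + e)             ≡⟨ cong (λ v → c + v) (ℤ.pos-+ z e) ⟨
    c + + (z ℕ.+ e)             ∎
    where
    open ≡-Reasoning
    cancel : ∀ c s e z → c - s + (e + (s + z)) ≡ c + (z + e)
    cancel = solve-∀

R≡-longInterval⇒R≡ : ∀ {h} (u : Vec ℤ h) (A : Vec (List ℤ) h) → (∀ i → lookup A i ≢ []) →
                     {t : ℕ} (B : SetZ) (c : ℤ) (K : ℕ) → requiredLength u A ≤ K →
                     (∀ k → k ≤ K → R≡ u A B (c + + k) t) → Σ SetZ λ B′ → ∀ n → R≡ u A B′ n t
R≡-longInterval⇒R≡ u A A≢[] {t} B c K long R≡-interval
  with a₀ , a₀∈A ← ∈Π-nonempty A A≢[]
  with i , j , i<j , j≤P , sameWindow ← repeatedWindow (λ e → B (c - offset u a₀ + + e)) (windowLength u A)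
         (λ e e<P+W → R≡-interval⇒decidable u A {c = c} {a = a₀} a₀∈A R≡-interval e (ℕ.<⇒≤ (ℕ.<-≤-trans e<P+W long)))
  = periodicExtension B q p , R≡-periodicExtension u A B q p window R≡-period
  where
  M = offsetBound u A
  W = windowLength u A
  β = c - offset u a₀
  p = j ℕ.∸ i
  instance
    p-nonZero : ℕ.NonZero p
    p-nonZero = ℕ.>-nonZero (ℕ.m<n⇒0<n∸m i<j)
  i+p≡j : i ℕ.+ p ≡ j
  i+p≡j = ℕ.m+[n∸m]≡n (ℕ.<⇒≤ i<j)
  q = β + + i
  window : ∀ r → r < W → B (q + + r) ⇔ B (q + + (p ℕ.+ r))
  window r r<W = subst₂ (λ x x′ → B x ⇔ B x′) (pos-+-assoc β i r)
    (trans (cong (λ v → β + + v) (trans (cong (ℕ._+ r) (sym i+p≡j)) (ℕ.+-assoc i p r))) (pos-+-assoc β i (p ℕ.+ r)))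
    (sameWindow r r<W)
  R≡-period : ∀ k → k < p → R≡ u A B (q + + (k ℕ.+ M)) t
  R≡-period k k<p = subst (λ x → R≡ u A B x t)
    (trans (cong (λ v → β + + v) (ℕ.+-assoc i k M)) (pos-+-assoc β i (k ℕ.+ M)))
    (R≡-interval⇒R≡-shifted u A {c = c} a₀∈A R≡-interval (i ℕ.+ k) (begin
      i ℕ.+ k ℕ.+ (M ℕ.+ M)   ≤⟨ ℕ.+-mono-≤ i+k≤2^W (ℕ.n≤1+n (M ℕ.+ M)) ⟩
      requiredLength u A      ≤⟨ long ⟩
      K                       ∎))
    where
    open ℕ.≤-Reasoning
    i+k≤2^W : i ℕ.+ k ≤ 2 ^ W
    i+k≤2^W = ℕ.<⇒≤ (ℕ.<-≤-trans (ℕ.+-monoʳ-< i k<p) (subst (_≤ 2 ^ W) (sym i+p≡j) j≤P))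

n≤f[n] : (f : ℕ → ℕ) → (∀ n → 1 ≤ n → 1 ≤ f n) → (∀ n → 1 ≤ n → f n < f (suc n)) → ∀ n → 1 ≤ n → n ≤ f n
n≤f[n] f f≥1 f↑ (suc zero)    _ = f≥1 1 (s≤s z≤n)
n≤f[n] f f≥1 f↑ (suc (suc n)) _ = ℕ.<-≤-trans (s≤s (n≤f[n] f f≥1 f↑ (suc n) (s≤s z≤n))) (f↑ (suc n) (s≤s z≤n))

mainTheorem4 : (h : ℕ) → 1 ≤ h → (u : Vec ℤ h) → (∀ i → lookup u i ≢ 0ℤ)
    → (A : Vec (List ℤ) h) → (∀ i → lookup A i ≢ [])
    → (t : ℕ) → 1 ≤ t
    → (L : ℕ → ℕ)
    → (∀ N → 1 ≤ N → 1 ≤ L N)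
    → (∀ N → 1 ≤ N → L N < L (suc N))
    → (∀ N → 1 ≤ N → Σ SetZ λ B → Σ ℤ λ c → ∀ k → k ≤ 2 * L N → R≡ u A B (c + + k) t)
    → Σ SetZ λ B → ∀ n → R≡ u A B n t
mainTheorem4 _ _ u _ A A≢[] t _ L L≥1 L↑ hyp with B , c , R≡-interval ← hyp (suc (requiredLength u A)) (s≤s z≤n) =
  R≡-longInterval⇒R≡ u A A≢[] B c (2 * L N) long R≡-interval
  where
  N = suc (requiredLength u A)
  long : requiredLength u A ≤ 2 * L N
  long = ℕ.≤-trans (ℕ.n≤1+n _) (ℕ.≤-trans (n≤f[n] L L≥1 L↑ N (s≤s z≤n)) (ℕ.m≤m+n (L N) _))
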